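{- Let $N,k$ be positive integers. Let $d,d'$ be distinct integers in the open interval $(N/2-N/(16k-2),\,N/2)$, and let $e=N-d$ and $e'=N-d'$. Let $\alpha,\alpha'\in[1,4k-1]$ be integers. Then no two of $\alpha d$, $\alpha' d'$, $\alpha e$, $\alpha' e'$ are equal. Moreover, if $\alpha<\alpha'$ then $\alpha d<\alpha' d'$ and $\alpha e<\alpha' e'$.
   Context: $[a,b]$ denotes the set of integers $\{a,a+1,\dots,b\}$. -}

module Defs where

open import Data.Nat as ℕ using (ℕ; suc; _*_; _∸_; _≤_; _<_; s≤s; z≤n; NonZero; >-nonZero)
open import Data.Nat.Properties using (*-monoʳ-≤; m<n⇒0<n∸m; ≤-trans)
open import Data.Integer as ℤ using (ℤ; +_)
open import Data.Rational using (ℚ; _/_; _-_)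

16k-2-nonZero : (k : ℕ) → .{{NonZero k}} → NonZero (16 * k ∸ 2)
16k-2-nonZero (suc j) = >-nonZero (m<n⇒0<n∸m {2} {16 * suc j} (≤-trans {3} {16} (s≤s (s≤s (s≤s z≤n))) (*-monoʳ-≤ 16 (s≤s (z≤n {j})))))

lowerBound : (N k : ℕ) → .{{NonZero k}} → ℚ
lowerBound N k = (+ N / 2) - _/_ (+ N) (16 * k ∸ 2) {{16k-2-nonZero k}}

upperBound : ℕ → ℚ
upperBound N = + N / 2

toℚ : ℤ → ℚ
toℚ z = z / 1

-- For d close to N/2 write d = N/2 - δ and e = N/2 + δ with 0 < δ < N/(16k-2).  Then α d lies
-- within αδ < N/4 below αN/2 and α e within αδ above it, so each of the four products lies in
-- an open quarter-interval ((j-1)N/4, jN/4): index 2α for α d and 2α+1 for α e.  Equal values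
-- have equal indices, which forces equal α (and then d = d') or an even index equal to an odd one;
-- the indices grow with α, which gives the inequalities.
module Submission where

open import Defs
open import Data.Nat as ℕ using (ℕ; NonZero)
open import Data.Integer using (ℤ; +_; _*_; _-_; _≤_; _<_)
open import Data.Rational as ℚ using (ℚ)
open import Data.Product using (_×_)
open import Relation.Binary.PropositionalEquality using (_≢_)

open import Data.Nat using (suc)
import Data.Nat.Properties as ℕ
open import Data.Integer using (_+_; -_; _⊖_; 0ℤ; 1ℤ; -1ℤ; pred; ∣_∣; positive; nonNegative; >-nonZero)
  renaming (suc to sucℤ)
open import Data.Integer.Properties
open import Data.Integer.Tactic.RingSolver using (solve-∀)
open import Data.Rational.Unnormalised as ℚᵘ using (mkℚᵘ; *<*)
import Data.Rational.Unnormalised.Properties as ℚᵘP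
import Data.Rational.Properties as ℚP
open import Data.Product using (_,_)
open import Relation.Binary.Definitions using (tri<; tri≈; tri>)
open import Relation.Binary.PropositionalEquality using (_≡_; refl; sym; trans; cong; subst)
open import Relation.Nullary using (contradiction)

open ≤-Reasoning

private
  variable
    i j k l t x y c : ℤ
    N : ℕ

<-resp-difference : ∀ {i j k l} → i < j → j - i ≡ l - k → k < l
<-resp-difference {i} {j} {k} {l} i<j eq = begin-strict
  k             ≡⟨ shift k i ⟩
  i + (k - i)   <⟨ +-monoˡ-< (k - i) i<j ⟩
  j + (k - i)   ≡⟨ regroup k i j ⟩
  k + (j - i)   ≡⟨ cong (λ m → k + m) eq ⟩
  k + (l - k)   ≡⟨ shift l k ⟨
  l             ∎
  where
  shift : ∀ a b → a ≡ b + (a - b)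
  shift = solve-∀
  regroup : ∀ a b c → c + (a - b) ≡ a + (c - b)
  regroup = solve-∀

pos*pos⇒pos : 0ℤ < i → 0ℤ < j → 0ℤ < i * j
pos*pos⇒pos {i} 0<i 0<j = subst (_< i * _) (*-zeroʳ i) (*-monoˡ-<-pos i {{positive 0<i}} 0<j)

sucℤ-injective : sucℤ i ≡ sucℤ j → i ≡ j
sucℤ-injective {i} {j} eq = trans (sym (pred-suc i)) (trans (cong pred eq) (pred-suc j))

i-j≡i-k⇒j≡k : i - j ≡ i - k → j ≡ k
i-j≡i-k⇒j≡k {i} {j} {k} eq = begin-equality
  j              ≡⟨ involutive i j ⟩
  i - (i - j)    ≡⟨ cong (λ m → i - m) eq ⟩
  i - (i - k)    ≡⟨ involutive i k ⟨
  k              ∎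
  where
  involutive : ∀ a b → b ≡ a - (a - b)
  involutive = solve-∀

even≢odd : ∀ i j → + 2 * i ≢ sucℤ (+ 2 * j)
even≢odd i j eq = ℕ.even≢odd ∣ i - j ∣ 0 (trans (sym (abs-* (+ 2) (i - j))) (cong ∣_∣ twice-diff≡1))
  where
  twice-diff≡1 : + 2 * (i - j) ≡ 1ℤ
  twice-diff≡1 = begin-equality
    + 2 * (i - j)               ≡⟨ distrib i j ⟩
    + 2 * i - + 2 * j           ≡⟨ cong (_- + 2 * j) eq ⟩
    sucℤ (+ 2 * j) - + 2 * j    ≡⟨ cancel (+ 2 * j) ⟩
    1ℤ                          ∎
    where
    distrib : ∀ a b → + 2 * (a - b) ≡ + 2 * a - + 2 * b
    distrib = solve-∀
    cancel : ∀ a → (1ℤ + a) - a ≡ 1ℤ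
    cancel = solve-∀

record InQuarter (N : ℕ) (k x : ℤ) : Set where
  constructor inQuarter
  field
    lower : pred k * + N < + 4 * x
    upper : + 4 * x < k * + N

InQuarter-< : InQuarter N k x → InQuarter N l y → k < l → x < y
InQuarter-< {N} {k} {x} {l} {y} (inQuarter _ 4x<kN) (inQuarter pred[l]N<4y _) k<l =
  *-cancelˡ-<-nonNeg (+ 4) (begin-strict
    + 4 * x       <⟨ 4x<kN ⟩
    k * + N       ≤⟨ *-monoʳ-≤-nonNeg (+ N) (i<j⇒i≤pred[j] k<l) ⟩
    pred l * + N  <⟨ pred[l]N<4y ⟩
    + 4 * y       ∎)

InQuarter-unique : InQuarter N k x → InQuarter N l y → x ≡ y → k ≡ l
InQuarter-unique {k = k} {l = l} qx qy refl with <-cmp k l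
... | tri< k<l _ _ = contradiction (InQuarter-< qx qy k<l) (<-irrefl refl)
... | tri≈ _ k≡l _ = k≡l
... | tri> _ _ l<k = contradiction (InQuarter-< qy qx l<k) (<-irrefl refl)

InQuarter-below : 0ℤ < t → t < + N → + 4 * x ≡ c * + N - t → InQuarter N c x
InQuarter-below {t} {N} {x} {c} 0<t t<N eq = inQuarter
  (begin-strict
    pred c * + N   ≡⟨ pred-* c (+ N) ⟩
    c * + N - + N  <⟨ +-monoʳ-< (c * + N) (neg-mono-< t<N) ⟩
    c * + N - t    ≡⟨ eq ⟨
    + 4 * x        ∎)
  (begin-strict
    + 4 * x        ≡⟨ eq ⟩
    c * + N - t    <⟨ +-monoʳ-< (c * + N) (neg-mono-< 0<t) ⟩
    c * + N + 0ℤ   ≡⟨ +-identityʳ (c * + N) ⟩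
    c * + N        ∎)
  where
  pred-* : ∀ a b → (-1ℤ + a) * b ≡ a * b - b
  pred-* = solve-∀

InQuarter-above : 0ℤ < t → t < + N → + 4 * x ≡ c * + N + t → InQuarter N (sucℤ c) x
InQuarter-above {t} {N} {x} {c} 0<t t<N eq = inQuarter
  (begin-strict
    pred (sucℤ c) * + N  ≡⟨ cong (_* + N) (pred-suc c) ⟩
    c * + N              ≡⟨ +-identityʳ (c * + N) ⟨
    c * + N + 0ℤ         <⟨ +-monoʳ-< (c * + N) 0<t ⟩
    c * + N + t          ≡⟨ eq ⟨
    + 4 * x              ∎)
  (begin-strict
    + 4 * x              ≡⟨ eq ⟩
    c * + N + t          <⟨ +-monoʳ-< (c * + N) t<N ⟩
    c * + N + + N        ≡⟨ +-comm (c * + N) (+ N) ⟩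
    + N + c * + N        ≡⟨ suc-* c (+ N) ⟨
    sucℤ c * + N         ∎)

toℚᵘ-/ : ∀ (i : ℤ) (n : ℕ) .{{_ : NonZero n}} → ℚ.toℚᵘ (i ℚ./ n) ℚᵘ.≃ mkℚᵘ i (ℕ.pred n)
toℚᵘ-/ i (suc n) = ℚP.toℚᵘ-fromℚᵘ (mkℚᵘ i n)

d<N/2⇒0<N-2d : ∀ d → toℚ d ℚ.< upperBound N → 0ℤ < + N - + 2 * d
d<N/2⇒0<N-2d {N} d d<N/2
  with ℚᵘP.<-respʳ-≃ (toℚᵘ-/ (+ N) 2) (ℚᵘP.<-respˡ-≃ (toℚᵘ-/ d 1) (ℚP.toℚᵘ-mono-< d<N/2))
... | *<* 2d<N = <-resp-difference 2d<N (rearrange (+ N) d)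
  where
  rearrange : ∀ n d → n * + 1 - d * + 2 ≡ (n - + 2 * d) - 0ℤ
  rearrange = solve-∀

N/2-N/m<d⇒m[N-2d]<2N : ∀ (m : ℕ) .{{_ : NonZero m}} d →
                        (+ N ℚ./ 2) ℚ.- (+ N ℚ./ m) ℚ.< toℚ d → + m * (+ N - + 2 * d) < + 2 * + N
N/2-N/m<d⇒m[N-2d]<2N {N} (suc m) d lower<d
  with ℚᵘP.<-respʳ-≃ (toℚᵘ-/ d 1) (ℚᵘP.<-respˡ-≃ lower≃ (ℚP.toℚᵘ-mono-< lower<d))
  where
  lower≃ : ℚ.toℚᵘ ((+ N ℚ./ 2) ℚ.- (+ N ℚ./ suc m)) ℚᵘ.≃ mkℚᵘ (+ N) 1 ℚᵘ.- mkℚᵘ (+ N) m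
  lower≃ = ℚᵘP.≃-trans (ℚP.toℚᵘ-homo-+ (+ N ℚ./ 2) (ℚ.- (+ N ℚ./ suc m)))
             (ℚᵘP.+-cong (toℚᵘ-/ (+ N) 2)
               (ℚᵘP.≃-trans (ℚP.toℚᵘ-homo‿- (+ N ℚ./ suc m)) (ℚᵘP.-‿cong (toℚᵘ-/ (+ N) (suc m)))))
... | *<* cross = <-resp-difference cross (rearrange (+ N) (+ suc m) d)
  where
  rearrange : ∀ n m d → d * (+ 2 * m) - (n * m + - n * + 2) * + 1 ≡ + 2 * n - m * (n - + 2 * d)
  rearrange = solve-∀

4α≤16k-2 : ∀ {α} (k : ℕ) .{{_ : NonZero k}} → α ≤ + (4 ℕ.* k) - 1ℤ → + 4 * α ≤ + (16 ℕ.* k ℕ.∸ 2)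
4α≤16k-2 {α} k α≤4k-1 = begin
  + 4 * α                   ≤⟨ *-monoˡ-≤-nonNeg (+ 4) α≤4k-1 ⟩
  + 4 * (+ (4 ℕ.* k) - 1ℤ)  ≡⟨ cong (λ m → + 4 * (m - 1ℤ)) (pos-* 4 k) ⟩
  + 4 * (+ 4 * + k - 1ℤ)    ≡⟨ expand (+ k) ⟩
  + 16 * + k - + 2 - + 2    ≤⟨ i-j≤i (+ 16 * + k - + 2) (+ 2) ⟩
  + 16 * + k - + 2          ≡⟨ cong (_- + 2) (pos-* 16 k) ⟨
  + (16 ℕ.* k) - + 2        ≡⟨ m-n≡m⊖n (16 ℕ.* k) 2 ⟩
  16 ℕ.* k ⊖ 2              ≡⟨ ⊖-≥ (ℕ.≤-trans (ℕ.m≤m+n 2 14) (ℕ.m≤m*n 16 k)) ⟩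
  + (16 ℕ.* k ℕ.∸ 2)        ∎
  where
  expand : ∀ k → + 4 * (+ 4 * k - 1ℤ) ≡ + 16 * k - + 2 - + 2
  expand = solve-∀

4α≤M⇒2αg<N : ∀ {M g} α → 0ℤ ≤ g → M * g < + 2 * + N → + 4 * α ≤ M → + 2 * α * g < + N
4α≤M⇒2αg<N {N} {M} {g} α 0≤g Mg<2N 4α≤M = *-cancelˡ-<-nonNeg (+ 2) (begin-strict
  + 2 * (+ 2 * α * g)  ≡⟨ regroup α g ⟩
  + 4 * α * g          ≤⟨ *-monoʳ-≤-nonNeg g {{nonNegative 0≤g}} 4α≤M ⟩
  M * g                <⟨ Mg<2N ⟩
  + 2 * + N            ∎)
  where
  regroup : ∀ a g → + 2 * (+ 2 * a * g) ≡ + 4 * a * g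
  regroup = solve-∀

module _ (N k : ℕ) .{{_ : NonZero k}} (d α : ℤ)
         (lo : lowerBound N k ℚ.< toℚ d) (hi : toℚ d ℚ.< upperBound N)
         (1≤α : + 1 ≤ α) (α≤4k-1 : α ≤ + (4 ℕ.* k) - 1ℤ) where

  private
    α-pos : 0ℤ < α
    α-pos = suc[i]≤j⇒i<j 1≤α

    gap : ℤ
    gap = + N - + 2 * d

    -- 4αδ for d = N/2 - δ
    deviation : ℤ
    deviation = + 2 * α * gap

    deviation-pos : 0ℤ < deviation
    deviation-pos = pos*pos⇒pos (*-monoˡ-<-pos (+ 2) α-pos) (d<N/2⇒0<N-2d d hi)

    deviation<N : deviation < + N
    deviation<N = 4α≤M⇒2αg<N α (<⇒≤ (d<N/2⇒0<N-2d d hi))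
                    (N/2-N/m<d⇒m[N-2d]<2N (16 ℕ.* k ℕ.∸ 2) {{16k-2-nonZero k}} d lo)
                    (4α≤16k-2 k α≤4k-1)

  α*d-quarter : InQuarter N (+ 2 * α) (α * d)
  α*d-quarter = InQuarter-below {c = + 2 * α} deviation-pos deviation<N (below (+ N) d α)
    where
    below : ∀ n d a → + 4 * (a * d) ≡ + 2 * a * n - + 2 * a * (n - + 2 * d)
    below = solve-∀

  α*e-quarter : InQuarter N (sucℤ (+ 2 * α)) (α * (+ N - d))
  α*e-quarter = InQuarter-above {c = + 2 * α} deviation-pos deviation<N (above (+ N) d α)
    where
    above : ∀ n d a → + 4 * (a * (n - d)) ≡ + 2 * a * n + + 2 * a * (n - + 2 * d)
    above = solve-∀

lemma11 : (N k : ℕ) → .{{_ : NonZero N}} → .{{_ : NonZero k}} →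
          (d d' : ℤ) → d ≢ d' →
          lowerBound N k ℚ.< toℚ d → toℚ d ℚ.< upperBound N →
          lowerBound N k ℚ.< toℚ d' → toℚ d' ℚ.< upperBound N →
          (α α' : ℤ) →
          + 1 ≤ α → α ≤ + (4 ℕ.* k) - + 1 →
          + 1 ≤ α' → α' ≤ + (4 ℕ.* k) - + 1 →
          let e = + N - d
              e' = + N - d'
          in ((α * d ≢ α' * d') × (α * d ≢ α * e) × (α * d ≢ α' * e')
              × (α' * d' ≢ α * e) × (α' * d' ≢ α' * e') × (α * e ≢ α' * e'))
             × (α < α' → (α * d < α' * d') × (α * e < α' * e'))
lemma11 N k d d' d≢d' lo hi lo' hi' α α' 1≤α α≤ 1≤α' α'≤ =
  ( (λ eq → d≢d' (cancel eq (InQuarter-unique αd α'd' eq)))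
  , (λ eq → even≢odd α α (InQuarter-unique αd αe eq))
  , (λ eq → even≢odd α α' (InQuarter-unique αd α'e' eq))
  , (λ eq → even≢odd α' α (InQuarter-unique α'd' αe eq))
  , (λ eq → even≢odd α' α' (InQuarter-unique α'd' α'e' eq))
  , (λ eq → d≢d' (i-j≡i-k⇒j≡k {i = + N}
                     (cancel eq (sucℤ-injective (InQuarter-unique αe α'e' eq))))) )
  , λ α<α' → InQuarter-< αd α'd' (*-monoˡ-<-pos (+ 2) α<α')
           , InQuarter-< αe α'e' (+-monoʳ-< 1ℤ (*-monoˡ-<-pos (+ 2) α<α'))
  where
  αd : InQuarter N (+ 2 * α) (α * d)
  αd = α*d-quarter N k d α lo hi 1≤α α≤
  αe : InQuarter N (sucℤ (+ 2 * α)) (α * (+ N - d))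
  αe = α*e-quarter N k d α lo hi 1≤α α≤
  α'd' : InQuarter N (+ 2 * α') (α' * d')
  α'd' = α*d-quarter N k d' α' lo' hi' 1≤α' α'≤
  α'e' : InQuarter N (sucℤ (+ 2 * α')) (α' * (+ N - d'))
  α'e' = α*e-quarter N k d' α' lo' hi' 1≤α' α'≤
  cancel : ∀ {x y} → α * x ≡ α' * y → + 2 * α ≡ + 2 * α' → x ≡ y
  cancel {x} {y} eq 2α≡2α' with *-cancelˡ-≡ (+ 2) α α' 2α≡2α'
  ... | refl = *-cancelˡ-≡ α x y {{>-nonZero (suc[i]≤j⇒i<j {i = 0ℤ} 1≤α)}} eq
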